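{- Let $k\geq 2$ be an integer and let $T$ be a tree with $n\geq 3$ vertices. Then $$\gamma_k(T)\leq \begin{cases}\frac{3k+1}{8}n & \text{if } k \text{ is odd},\\ \frac{3k}{8}n & \text{if } k \text{ is even};\end{cases}\qquad \gamma_k^s(T)\leq \begin{cases}\frac{3k+1}{8}n & \text{if } k \text{ is odd},\\ \frac{2k}{5}n & \text{if } k\in\{2,4,6\},\\ \frac{3k}{8}n & \text{if } k\geq 8 \text{ and } k \text{ is even}.\end{cases}$$
   Context: Let $G=(V,E)$ be a finite simple graph and $k$ a positive integer. For a vertex $u$, $N_G(u)$ is its open neighbourhood and $N_G[u]=N_G(u)\cup\{u\}$. For $f:V\to\{0,1,\dots,k\}$ let $w(f)=\sum_{v\in V}f(v)$. $f$ is a Roman $k$-dominating function ($k$-RDF) if every $u$ with $f(u)<k/2$ satisfies $\sum_{v\in N_G[u]}f(v)\geq k$; it is a strong Roman $k$-dominating function ($k$-SRDF) if every $u$ with $f(u)<k/2$ satisfies $f(u)+\sum_{v\in N_G(u),\, f(v)>k/2}f(v)\geq k$. $\gamma_k(G)$ (resp. $\gamma_k^s(G)$) is the minimum weight of a $k$-RDF (resp. $k$-SRDF) of $G$. -}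

module Defs where

open import Data.Nat using (ℕ; zero; suc; _+_; _*_; _≤_; _<_; _>_; _%_)
open import Data.Fin using (Fin)
open import Data.Bool using (Bool; true; false; if_then_else_)
open import Data.List using (List; []; _∷_; length; map; allFin; last)
open import Data.Nat.ListAction using (sum)
open import Data.List.Relation.Unary.Linked using (Linked)
open import Data.List.Relation.Unary.Unique.Propositional using (Unique)
open import Data.Maybe using (just)
open import Data.Product using (Σ; _×_; ∃)
open import Data.Empty using (⊥)
open import Relation.Nullary using (¬_)
open import Relation.Nullary.Decidable using (⌊_⌋)
open import Relation.Binary.PropositionalEquality using (_≡_)
import Data.Nat as ℕ

record SimpleGraph (n : ℕ) : Set where
  field
    adj    : Fin n → Fin n → Bool
    sym    : ∀ u v → adj u v ≡ adj v u
    irrefl : ∀ u → adj u u ≡ false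
open SimpleGraph public

Adj : ∀ {n} → SimpleGraph n → Fin n → Fin n → Set
Adj G u v = adj G u v ≡ true

data Walk {n : ℕ} (G : SimpleGraph n) : Fin n → Fin n → Set where
  nil  : ∀ {u} → Walk G u u
  cons : ∀ {u v w} → Adj G u v → Walk G v w → Walk G u w

Connected : ∀ {n} → SimpleGraph n → Set
Connected G = ∀ u v → Walk G u v

record Cycle {n : ℕ} (G : SimpleGraph n) : Set where
  field
    first    : Fin n
    rest     : List (Fin n)
    long     : 2 ≤ length rest
    distinct : Unique (first ∷ rest)
    linked   : Linked (Adj G) (first ∷ rest)
    closing  : ∀ x → last rest ≡ just x → Adj G x first

Acyclic : ∀ {n} → SimpleGraph n → Set
Acyclic G = ¬ Cycle G

IsTree : ∀ {n} → SimpleGraph n → Set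
IsTree G = Connected G × Acyclic G

Σᵥ : ∀ {n} → (Fin n → ℕ) → ℕ
Σᵥ {n} g = sum (map g (allFin n))

weight : ∀ {n} → (Fin n → ℕ) → ℕ
weight f = Σᵥ f

nbSum : ∀ {n} → SimpleGraph n → (Fin n → ℕ) → Fin n → ℕ
nbSum G f u = Σᵥ (λ v → if adj G u v then f v else 0)

-- Σ_{v ∈ N(u), f(v) > k/2} f(v)   (f(v) > k/2  ⇔  2 f(v) > k)
strongNbSum : ∀ {n} → ℕ → SimpleGraph n → (Fin n → ℕ) → Fin n → ℕ
strongNbSum k G f u =
  Σᵥ (λ v → if adj G u v then (if ⌊ k ℕ.<? 2 * f v ⌋ then f v else 0) else 0)

-- f : V → {0,…,k};  f(u) < k/2 is written 2 f(u) < k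
IsRDF : ∀ {n} → ℕ → SimpleGraph n → (Fin n → ℕ) → Set
IsRDF k G f = (∀ v → f v ≤ k)
            × (∀ u → 2 * f u < k → k ≤ f u + nbSum G f u)

IsSRDF : ∀ {n} → ℕ → SimpleGraph n → (Fin n → ℕ) → Set
IsSRDF k G f = (∀ v → f v ≤ k)
             × (∀ u → 2 * f u < k → k ≤ f u + strongNbSum k G f u)

-- γ_k(G) ≤ b  ⇔  some k-RDF has weight ≤ b ; bounds b = (p/q)·n are
-- stated as q · w(f) ≤ p · n.
γ-bound : ∀ {n} → ℕ → SimpleGraph n → (q p : ℕ) → Set
γ-bound {n} k G q p = ∃ λ f → IsRDF k G f × q * weight f ≤ p * n

γs-bound : ∀ {n} → ℕ → SimpleGraph n → (q p : ℕ) → Set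
γs-bound {n} k G q p = ∃ λ f → IsSRDF k G f × q * weight f ≤ p * n

{-# OPTIONS --safe #-}

-- Every connected graph on at least three vertices has a spanning forest of spiders, that is,
-- of stars whose legs have length one or two, each spider having at least three vertices.
-- Such a cover is grown one vertex at a time: an uncovered neighbour of a covered vertex is
-- attached to that vertex's spider, which is restructured locally, and a centre left with too
-- few vertices is merged into a neighbouring spider.
--
-- On a spider with A legs of length one and B legs of length two, one of four patterns of
-- values in {0, h, s, k}, where h ≥ k/2 and s > k/2, is a (strong) Roman k-dominating function
-- using only the edges of the spider; it is chosen from (A, B) so that its weight is at most
-- p/q times the 1 + A + 2B vertices of the spider. Summing over the spiders bounds the weight
-- by p n / q.

module Submission where

open import Defs renaming (sym to adj-sym)
open import Data.Nat using (ℕ; zero; suc; _+_; _*_; _≤_; _<_; _%_; z≤n; s≤s)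
import Data.Nat as ℕ
open import Data.Nat.Properties
  using ( +-*-semiring; +-comm; +-assoc; +-identityʳ; *-identityʳ; *-zeroʳ; *-suc
        ; *-distribʳ-+; *-distribˡ-+; suc-injective; ≤-refl; ≤-reflexive; ≤-trans
        ; +-mono-≤; +-monoʳ-≤; <⇒≢; <⇒≤; <⇒≱; m<n+m; m≤n+m; m≤m+n; module ≤-Reasoning )
open import Data.Nat.Tactic.RingSolver using (solve)
open import Algebra.Properties.Semiring.Sum +-*-semiring
  using (sum; sum-cong-≗; ∑-distrib-+; ∑-comm; *-distribˡ-sum; sum-replicate-zero)
import Data.Nat.ListAction as List
open import Data.Fin using (Fin; zero; suc; _≟_)
open import Data.Fin.Properties using (any?)
open import Data.List using (List; []; _∷_; map; tabulate)
open import Data.List.Properties using (map-tabulate)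
open import Data.List.Relation.Unary.Any using (here; there)
import Data.List.Membership.DecPropositional as Membership
open import Data.Vec.Functional using (updateAt)
open import Data.Vec.Functional.Properties using (updateAt-updates; updateAt-minimal)
open import Data.Bool using (true; false; if_then_else_)
open import Data.Product using (_×_; _,_; ∃-syntax; ∃₂; proj₁; proj₂)
open import Data.Sum using (_⊎_; inj₁; inj₂; [_,_])
open import Data.Unit using (⊤; tt)
open import Data.Empty using (⊥; ⊥-elim)
open import Function using (_∘_; id; const)
open import Relation.Nullary using (¬_; Dec; yes; no)
open import Relation.Nullary.Decidable using (⌊_⌋; _×-dec_; _⊎-dec_; ¬?)
open import Relation.Nullary.Negation using (contradiction)
open import Relation.Unary using (Decidable)
open import Relation.Binary.PropositionalEquality
  using (_≡_; _≢_; refl; sym; trans; cong; cong₂; subst; subst₂; module ≡-Reasoning)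

Σᵥ≡sum : ∀ {n} (g : Fin n → ℕ) → Σᵥ g ≡ sum g
Σᵥ≡sum {n} g = trans (cong List.sum (map-tabulate id g)) (tabulated n g)
  where
  tabulated : ∀ n (g : Fin n → ℕ) → List.sum (tabulate g) ≡ sum g
  tabulated zero    g = refl
  tabulated (suc n) g = cong (g zero +_) (tabulated n (g ∘ suc))

sum-mono-≤ : ∀ {n} {g h : Fin n → ℕ} → (∀ v → g v ≤ h v) → sum g ≤ sum h
sum-mono-≤ {zero}  g≤h = z≤n
sum-mono-≤ {suc n} g≤h = +-mono-≤ (g≤h zero) (sum-mono-≤ (g≤h ∘ suc))

sum-const : ∀ n p → sum {n} (λ _ → p) ≡ p * n
sum-const zero    p = sym (*-zeroʳ p)
sum-const (suc n) p = trans (cong (p +_) (sum-const n p)) (sym (*-suc p n))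

when : ∀ {a} {P : Set a} → Dec P → ℕ → ℕ
when (yes _) x = x
when (no _)  x = 0

when-yes : ∀ {a} {P : Set a} (d : Dec P) {x} → P → when d x ≡ x
when-yes (yes _) p = refl
when-yes (no ¬p) p = contradiction p ¬p

when-no : ∀ {a} {P : Set a} (d : Dec P) {x} → ¬ P → when d x ≡ 0
when-no (yes p) ¬p = contradiction p ¬p
when-no (no _)  ¬p = refl

when-≤ : ∀ {a} {P : Set a} (d : Dec P) x → when d x ≤ x
when-≤ (yes _) x = ≤-refl
when-≤ (no _)  x = z≤n

when-sym : ∀ {n} (a b : Fin n) x → when (a ≟ b) x ≡ when (b ≟ a) x
when-sym a b x with a ≟ b | b ≟ a
... | yes _    | yes _    = refl
... | no _     | no _     = refl
... | yes refl | no b≢a   = contradiction refl b≢a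
... | no a≢b   | yes refl = contradiction refl a≢b

sum-point : ∀ {n} (a : Fin n) (g : Fin n → ℕ) → sum (λ v → when (a ≟ v) (g v)) ≡ g a
sum-point {suc n} zero g = trans (cong (g zero +_) rest) (+-identityʳ (g zero))
  where
  rest : sum {n} (λ v → when (zero ≟ suc v) (g (suc v))) ≡ 0
  rest = sum-replicate-zero n
sum-point {suc n} (suc a) g = trans (sum-cong-≗ {n} shift) (sum-point a (g ∘ suc))
  where
  shift : ∀ v → when (suc a ≟ suc v) (g (suc v)) ≡ when (a ≟ v) (g (suc v))
  shift v with a ≟ v
  ... | yes _ = refl
  ... | no _  = refl

point≤sum : ∀ {n} (g : Fin n → ℕ) a → g a ≤ sum g
point≤sum g a = subst (_≤ sum g) (sum-point a g) (sum-mono-≤ (λ v → when-≤ (a ≟ v) (g v)))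

pair≤sum : ∀ {n} (g : Fin n → ℕ) {a b} → a ≢ b → g a + g b ≤ sum g
pair≤sum g {a} {b} a≢b =
  subst (_≤ sum g) (trans (∑-distrib-+ at-a at-b) (cong₂ _+_ (sum-point a g) (sum-point b g)))
        (sum-mono-≤ split)
  where
  at-a at-b : Fin _ → ℕ
  at-a v = when (a ≟ v) (g v)
  at-b v = when (b ≟ v) (g v)
  split : ∀ v → at-a v + at-b v ≤ g v
  split v with a ≟ v | b ≟ v
  ... | yes refl | yes refl = contradiction refl a≢b
  ... | yes _    | no _     = ≤-reflexive (+-identityʳ (g v))
  ... | no _     | d        = when-≤ d (g v)

sum-fibres : ∀ {n} (π : Fin n → Fin n) (g : Fin n → ℕ) →
             sum g ≡ sum (λ c → sum (λ v → when (π v ≟ c) (g v)))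
sum-fibres π g = trans (sum-cong-≗ (λ v → sym (sum-point (π v) (λ _ → g v))))
                       (∑-comm (λ v c → when (π v ≟ c) (g v)))

sum-positive : ∀ {n} (g : Fin n → ℕ) → 0 < sum g → ∃[ v ] 0 < g v
sum-positive {suc n} g pos with g zero in eq
... | suc _ = zero , subst (0 <_) (sym eq) (s≤s z≤n)
... | zero  with sum-positive (g ∘ suc) pos
...   | v , gv>0 = suc v , gv>0

count : ∀ {n} {P : Fin n → Set} → Decidable P → ℕ
count P? = sum (λ v → when (P? v) 1)

sum-when : ∀ {n} {P : Fin n → Set} (P? : Decidable P) x → sum (λ v → when (P? v) x) ≡ x * count P?
sum-when P? x = trans (sum-cong-≗ scale) (sym (*-distribˡ-sum x (λ v → when (P? v) 1)))
  where
  scale : ∀ v → when (P? v) x ≡ x * when (P? v) 1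
  scale v with P? v
  ... | yes _ = sym (*-identityʳ x)
  ... | no _  = sym (*-zeroʳ x)

count-bijection : ∀ {n} {P Q : Fin n → Set} (P? : Decidable P) (Q? : Decidable Q)
                  (to from : Fin n → Fin n) →
                  (∀ {v} → P v → Q (to v)) → (∀ {u} → Q u → P (from u)) →
                  (∀ {v} → P v → from (to v) ≡ v) → (∀ {u} → Q u → to (from u) ≡ u) →
                  count P? ≡ count Q?
count-bijection {n} {P} {Q} P? Q? to from P⇒Q Q⇒P from∘to to∘from =
  trans (sum-fibres to (λ v → when (P? v) 1)) (sum-cong-≗ fibre)
  where
  fibre : ∀ u → sum (λ v → when (to v ≟ u) (when (P? v) 1)) ≡ when (Q? u) 1
  fibre u with Q? u
  ... | yes q = trans (sum-cong-≗ only-from) (sum-point (from u) (λ _ → 1))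
    where
    only-from : ∀ v → when (to v ≟ u) (when (P? v) 1) ≡ when (from u ≟ v) 1
    only-from v with P? v | to v ≟ u | from u ≟ v
    ... | yes _ | yes _    | yes _    = refl
    ... | yes p | yes refl | no ≢v    = contradiction (from∘to p) ≢v
    ... | yes _ | no ≢u    | yes refl = contradiction (to∘from q) ≢u
    ... | yes _ | no _     | no _     = refl
    ... | no ¬p | _        | yes refl = contradiction (Q⇒P q) ¬p
    ... | no _  | yes _    | no _     = refl
    ... | no _  | no _     | no _     = refl
  ... | no ¬q = trans (sum-cong-≗ none) (sum-replicate-zero n)
    where
    none : ∀ v → when (to v ≟ u) (when (P? v) 1) ≡ 0
    none v with P? v | to v ≟ u
    ... | yes p | yes refl = contradiction (P⇒Q p) ¬q
    ... | yes _ | no _     = refl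
    ... | no _  | yes _    = refl
    ... | no _  | no _     = refl

module _ {n} (G : SimpleGraph n) where

  Adj-sym : ∀ {u v} → Adj G u v → Adj G v u
  Adj-sym {u} {v} u~v = trans (adj-sym G v u) u~v

  Adj⇒≢ : ∀ {u v} → Adj G u v → u ≢ v
  Adj⇒≢ {u} u~u refl = contradiction (trans (sym (irrefl G u)) u~u) λ ()

  walk-crosses : ∀ {P : Fin n → Set} → Decidable P → ∀ {a z} → Walk G a z → P a → ¬ P z →
                 ∃₂ λ x y → ¬ P x × P y × Adj G y x
  walk-crosses P? nil                     pa ¬pz = contradiction pa ¬pz
  walk-crosses P? (cons {v = v} a~v walk) pa ¬pz with P? v
  ... | yes pv = walk-crosses P? walk pv ¬pz
  ... | no ¬pv = v , _ , ¬pv , pa , a~v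

another-vertex : ∀ {n} {v₀ v₁ v₂ : Fin n} → v₀ ≢ v₁ → v₀ ≢ v₂ → v₁ ≢ v₂ →
                 ∀ b → ∃[ z ] z ≢ v₀ × z ≢ b
another-vertex {v₁ = v₁} {v₂} v₀≢v₁ v₀≢v₂ v₁≢v₂ b with b ≟ v₁
... | yes refl = v₂ , v₀≢v₂ ∘ sym , v₁≢v₂ ∘ sym
... | no b≢v₁  = v₁ , v₀≢v₁ ∘ sym , b≢v₁ ∘ sym

module _ {n} (G : SimpleGraph n) (f : Fin n → ℕ) (u : Fin n) where

  private
    nb : Fin n → ℕ
    nb v = if adj G u v then f v else 0

    strongNb : ℕ → Fin n → ℕ
    strongNb k v = if adj G u v then (if ⌊ k ℕ.<? 2 * f v ⌋ then f v else 0) else 0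

    nb-adj : ∀ {v} → Adj G u v → nb v ≡ f v
    nb-adj a rewrite a = refl

    strongNb-adj : ∀ {k v} → Adj G u v → k < 2 * f v → strongNb k v ≡ f v
    strongNb-adj {k} {v} a k<2fv rewrite a with k ℕ.<? 2 * f v
    ... | yes _     = refl
    ... | no k≮2fv  = contradiction k<2fv k≮2fv

    strongNb≤nb : ∀ k v → strongNb k v ≤ nb v
    strongNb≤nb k v with adj G u v
    ... | false = z≤n
    ... | true with k ℕ.<? 2 * f v
    ...   | yes _ = ≤-refl
    ...   | no _  = z≤n

  strongNbSum≤nbSum : ∀ k → strongNbSum k G f u ≤ nbSum G f u
  strongNbSum≤nbSum k =
    subst₂ _≤_ (sym (Σᵥ≡sum (strongNb k))) (sym (Σᵥ≡sum nb)) (sum-mono-≤ (strongNb≤nb k))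

  strongNbSum-neighbour : ∀ {k v} → Adj G u v → k < 2 * f v → f v ≤ strongNbSum k G f u
  strongNbSum-neighbour {k} {v} a k<2fv =
    subst₂ _≤_ (strongNb-adj a k<2fv) (sym (Σᵥ≡sum (strongNb k))) (point≤sum (strongNb k) v)

  strongNbSum-neighbours : ∀ {k v w} → Adj G u v → Adj G u w → v ≢ w →
                           k < 2 * f v → k < 2 * f w → f v + f w ≤ strongNbSum k G f u
  strongNbSum-neighbours {k} a b v≢w k<2fv k<2fw =
    subst₂ _≤_ (cong₂ _+_ (strongNb-adj a k<2fv) (strongNb-adj b k<2fw)) (sym (Σᵥ≡sum (strongNb k)))
               (pair≤sum (strongNb k) v≢w)

  nbSum-neighbours : ∀ {v w} → Adj G u v → Adj G u w → v ≢ w → f v + f w ≤ nbSum G f u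
  nbSum-neighbours a b v≢w =
    subst₂ _≤_ (cong₂ _+_ (nb-adj a) (nb-adj b)) (sym (Σᵥ≡sum nb)) (pair≤sum nb v≢w)

-- Spider labellings

-- leaf c is a leaf of the spider with centre c, knee c w the middle vertex of a leg from c
-- whose end is w, and foot u the end of the leg through the knee u; outside vertices are
-- not yet covered.
data Label (n : ℕ) : Set where
  outside centre : Label n
  leaf           : (c : Fin n) → Label n
  knee           : (c w : Fin n) → Label n
  foot           : (u : Fin n) → Label n

Labelling : ℕ → Set
Labelling n = Fin n → Label n

Refers : ∀ {n} → Label n → Fin n → Set
Refers (leaf c)   z = z ≡ c
Refers (knee c w) z = z ≡ c ⊎ z ≡ w
Refers (foot u)   z = z ≡ u
Refers outside    z = ⊥
Refers centre     z = ⊥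

refers-via : ∀ {n} {d d′ : Label n} {z} → d ≡ d′ → Refers d z → Refers d′ z
refers-via refl r = r

distinct : ∀ {n} {L : Labelling n} {u v d d′} → L u ≡ d → L v ≡ d′ → d ≢ d′ → u ≢ v
distinct u≡ v≡ d≢d′ refl = d≢d′ (trans (sym u≡) v≡)

label-≢ : ∀ {n} {x d d′ : Label n} → x ≡ d → d ≢ d′ → x ≢ d′
label-≢ v≡ d≢d′ e = d≢d′ (trans (sym v≡) e)

knee-injectiveˡ : ∀ {n} {c c′ w w′ : Fin n} → knee c w ≡ knee c′ w′ → c ≡ c′
knee-injectiveˡ refl = refl

centre? : ∀ {n} (d : Label n) → Dec (d ≡ centre)
centre? centre     = yes refl
centre? outside    = no λ ()
centre? (leaf _)   = no λ ()
centre? (knee _ _) = no λ ()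
centre? (foot _)   = no λ ()

leaf? : ∀ {n} c (d : Label n) → Dec (d ≡ leaf c)
leaf? c (leaf c′) with c′ ≟ c
... | yes refl = yes refl
... | no c′≢c  = no λ { refl → c′≢c refl }
leaf? c outside    = no λ ()
leaf? c centre     = no λ ()
leaf? c (knee _ _) = no λ ()
leaf? c (foot _)   = no λ ()

knee? : ∀ {n} c (d : Label n) → Dec (∃[ w ] d ≡ knee c w)
knee? c (knee c′ w) with c′ ≟ c
... | yes refl = yes (w , refl)
... | no c′≢c  = no λ { (_ , refl) → c′≢c refl }
knee? c outside  = no λ ()
knee? c centre   = no λ ()
knee? c (leaf _) = no λ ()
knee? c (foot _) = no λ ()

module _ {n : ℕ} (G : SimpleGraph n) where

  CoherentAt : Labelling n → Fin n → Label n → Set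
  CoherentAt L v outside    = ⊤
  CoherentAt L v centre     = ⊤
  CoherentAt L v (leaf c)   = L c ≡ centre × Adj G v c
  CoherentAt L v (knee c w) = L c ≡ centre × Adj G v c × L w ≡ foot v
  CoherentAt L v (foot u)   = (∃[ c ] L u ≡ knee c v) × Adj G v u

  Coherent : Labelling n → Fin n → Set
  Coherent L v = CoherentAt L v (L v)

  coherent-as : ∀ {L v} d → Coherent L v → L v ≡ d → CoherentAt L v d
  coherent-as {L} {v} d coh v≡ = subst (CoherentAt L v) v≡ coh

  coherent-at : ∀ {L v} d → L v ≡ d → CoherentAt L v d → Coherent L v
  coherent-at {L} {v} d v≡ = subst (CoherentAt L v) (sym v≡)

  Big : Labelling n → Fin n → Set
  Big L c = (∃₂ λ u w → L u ≡ knee c w)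
          ⊎ (∃₂ λ l l′ → l ≢ l′ × L l ≡ leaf c × L l′ ≡ leaf c)

  AlmostValid : Fin n → Labelling n → Set
  AlmostValid c₀ L = (∀ v → Coherent L v) × (∀ c → c ≢ c₀ → L c ≡ centre → Big L c)

  Valid : Labelling n → Set
  Valid L = (∀ v → Coherent L v) × (∀ c → L c ≡ centre → Big L c)

  valid⇒almostValid : ∀ {L} c₀ → Valid L → AlmostValid c₀ L
  valid⇒almostValid c₀ (coh , big) = coh , λ c _ → big c

  almostValid⇒valid : ∀ {L c₀} → AlmostValid c₀ L → (L c₀ ≡ centre → Big L c₀) → Valid L
  almostValid⇒valid {L} {c₀} (coh , big) big₀ = coh , big′
    where
    big′ : ∀ c → L c ≡ centre → Big L c
    big′ c with c ≟ c₀
    ... | yes refl = big₀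
    ... | no c≢c₀  = big c c≢c₀

  data ReferredBy (v : Fin n) : Label n → Set where
    as-centre : ReferredBy v centre
    as-knee   : ∀ {c} → ReferredBy v (knee c v)
    as-foot   : ReferredBy v (foot v)

  referredBy : ∀ {L v z} → Coherent L v → Refers (L v) z → ReferredBy v (L z)
  referredBy {L} {v} coh r with L v
  referredBy (c≡ , _)     refl       | leaf _   = subst (ReferredBy _) (sym c≡) as-centre
  referredBy (c≡ , _ , _) (inj₁ refl) | knee _ _ = subst (ReferredBy _) (sym c≡) as-centre
  referredBy (_ , _ , w≡) (inj₂ refl) | knee _ _ = subst (ReferredBy _) (sym w≡) as-foot
  referredBy ((_ , u≡) , _) refl     | foot _   = subst (ReferredBy _) (sym u≡) as-knee

  CoherentAt-transfer : ∀ {L L′ v} d → CoherentAt L v d → (∀ z → Refers d z → L′ z ≡ L z) →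
                        CoherentAt L′ v d
  CoherentAt-transfer outside    _ _ = tt
  CoherentAt-transfer centre     _ _ = tt
  CoherentAt-transfer (leaf c)   (c≡ , a) same = trans (same c refl) c≡ , a
  CoherentAt-transfer (knee c w) (c≡ , a , w≡) same =
    trans (same c (inj₁ refl)) c≡ , a , trans (same w (inj₂ refl)) w≡
  CoherentAt-transfer (foot u)   ((c , u≡) , a) same = (c , trans (same u refl) u≡) , a

  Big-transfer : ∀ {L L′ c} → Big L c → (∀ u → Refers (L u) c → L′ u ≡ L u) → Big L′ c
  Big-transfer (inj₁ (u , w , u≡)) same =
    inj₁ (u , w , trans (same u (refers-via (sym u≡) (inj₁ refl))) u≡)
  Big-transfer (inj₂ (l , l′ , l≢l′ , l≡ , l′≡)) same =
    inj₂ (l , l′ , l≢l′ , trans (same l (refers-via (sym l≡) refl)) l≡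
                        , trans (same l′ (refers-via (sym l′≡) refl)) l′≡)

  -- Labels outside T stay coherent if none of them refers into T, and a centre outside T
  -- stays big unless a vertex of T referred to it, which only c₀ may suffer.
  relabel-almostValid : ∀ {L L′ : Labelling n} {T : Fin n → Set} (T? : Decidable T) c₀ →
    AlmostValid c₀ L →
    (∀ v → ¬ T v → L′ v ≡ L v) →
    (∀ v z → Refers (L v) z → T z → T v) →
    (∀ u z → T u → Refers (L u) z → T z ⊎ z ≡ c₀) →
    (∀ v → T v → Coherent L′ v) →
    (∀ c → T c → L′ c ≡ centre → Big L′ c) →
    AlmostValid c₀ L′
  relabel-almostValid {L} {L′} {T} T? c₀ (coh , big) kept into out coh-T big-T = coh′ , big′
    where
    coh′ : ∀ v → Coherent L′ v
    coh′ v with T? v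
    ... | yes t = coh-T v t
    ... | no ¬t = subst (CoherentAt L′ v) (sym (kept v ¬t))
                    (CoherentAt-transfer (L v) (coh v) λ z r → kept z (λ t → ¬t (into v z r t)))
    big′ : ∀ c → c ≢ c₀ → L′ c ≡ centre → Big L′ c
    big′ c c≢c₀ c≡ with T? c
    ... | yes t = big-T c t c≡
    ... | no ¬t = Big-transfer (big c c≢c₀ (trans (sym (kept c ¬t)) c≡)) λ u r → kept u λ t →
                    [ ¬t , c≢c₀ ] (out u c t r)

  referrer-of-centre : ∀ {L v z} → Coherent L v → L z ≡ centre → Refers (L v) z →
                       L v ≡ leaf z ⊎ ∃[ w ] L v ≡ knee z w
  referrer-of-centre {L} {v} coh z≡ r with L v
  ... | leaf _   = inj₁ (cong leaf (sym r))
  ... | knee _ w with r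
  ...   | inj₁ refl = inj₂ (w , refl)
  ...   | inj₂ refl = contradiction (trans (sym z≡) (proj₂ (proj₂ coh))) λ ()
  referrer-of-centre {L} coh z≡ refl | foot _
    = contradiction (trans (sym z≡) (proj₂ (proj₁ coh))) λ ()

  referrer-of-knee : ∀ {L v z c w} → Coherent L v → L z ≡ knee c w → Refers (L v) z → v ≡ w
  referrer-of-knee coh z≡ r = inv (subst (ReferredBy _) z≡ (referredBy coh r))
    where
    inv : ∀ {v c w} → ReferredBy v (knee c w) → v ≡ w
    inv as-knee = refl

  referrer-of-foot : ∀ {L v z u} → Coherent L v → L z ≡ foot u → Refers (L v) z → v ≡ u
  referrer-of-foot coh z≡ r = inv (subst (ReferredBy _) z≡ (referredBy coh r))
    where
    inv : ∀ {v u} → ReferredBy v (foot u) → v ≡ u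
    inv as-foot = refl

  no-referrer-of-leaf : ∀ {L v z c} → Coherent L v → L z ≡ leaf c → ¬ Refers (L v) z
  no-referrer-of-leaf coh z≡ r with subst (ReferredBy _) z≡ (referredBy coh r)
  ... | ()

  no-referrer-of-outside : ∀ {L v z} → Coherent L v → L z ≡ outside → ¬ Refers (L v) z
  no-referrer-of-outside coh z≡ r with subst (ReferredBy _) z≡ (referredBy coh r)
  ... | ()

  data Children (L : Labelling n) (c : Fin n) : Set where
    many   : Big L c → Children L c
    single : ∀ ℓ → L ℓ ≡ leaf c → (∀ v → L v ≡ leaf c → v ≡ ℓ) →
             (∀ v w → L v ≢ knee c w) → Children L c
    none   : (∀ v → L v ≢ leaf c) → (∀ v w → L v ≢ knee c w) → Children L c

  children : ∀ L c → Children L c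
  children L c with any? (λ u → knee? c (L u))
  ... | yes (u , w , u≡) = many (inj₁ (u , w , u≡))
  ... | no no-knee with any? (λ l → leaf? c (L l))
  ...   | no no-leaf = none (λ v v≡ → no-leaf (v , v≡)) (λ v w v≡ → no-knee (v , w , v≡))
  ...   | yes (ℓ , ℓ≡) with any? (λ l → ¬? (ℓ ≟ l) ×-dec leaf? c (L l))
  ...     | yes (ℓ′ , ℓ≢ℓ′ , ℓ′≡) = many (inj₂ (ℓ , ℓ′ , ℓ≢ℓ′ , ℓ≡ , ℓ′≡))
  ...     | no no-other = single ℓ ℓ≡ only (λ v w v≡ → no-knee (v , w , v≡))
    where
    only : ∀ v → L v ≡ leaf c → v ≡ ℓ
    only v v≡ with ℓ ≟ v
    ... | yes ℓ≡v = sym ℓ≡v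
    ... | no ℓ≢v  = contradiction (v , ℓ≢v , v≡) no-other

-- Growing a spider cover

module _ {n : ℕ} (G : SimpleGraph n) where

  open Membership (_≟_ {n}) using (_∈_; _∉_; _∈?_)

  _[_≔_] : Labelling n → Fin n → Label n → Labelling n
  L [ v ≔ d ] = updateAt L v (const d)

  ≔-hit : ∀ L v (d : Label n) → (L [ v ≔ d ]) v ≡ d
  ≔-hit L v d = updateAt-updates v L

  ≔-miss : ∀ L {u v} (d : Label n) → u ≢ v → (L [ v ≔ d ]) u ≡ L u
  ≔-miss L {u} {v} d u≢v = updateAt-minimal u v L u≢v

  Changes : Set
  Changes = List (Fin n × Label n)

  changed : Changes → List (Fin n)
  changed = map proj₁

  relabelling : Changes → Labelling n → Labelling n
  relabelling []             L = L
  relabelling ((v , d) ∷ cs) L = relabelling cs L [ v ≔ d ]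

  relabelling-kept : ∀ cs L {v} → v ∉ changed cs → relabelling cs L v ≡ L v
  relabelling-kept []             L v∉ = refl
  relabelling-kept ((u , d) ∷ cs) L v∉ =
    trans (≔-miss (relabelling cs L) d (v∉ ∘ here)) (relabelling-kept cs L (v∉ ∘ there))

  relabelling-almostValid : ∀ {L} cs c₀ → AlmostValid G c₀ L →
    (∀ v z → Refers (L v) z → z ∈ changed cs → v ∈ changed cs) →
    (∀ u z → u ∈ changed cs → Refers (L u) z → z ∈ changed cs ⊎ z ≡ c₀) →
    (∀ v → v ∈ changed cs → Coherent G (relabelling cs L) v) →
    (∀ c → c ∈ changed cs → relabelling cs L c ≡ centre → Big G (relabelling cs L) c) →
    AlmostValid G c₀ (relabelling cs L)
  relabelling-almostValid {L} cs c₀ av =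
    relabel-almostValid G (_∈? changed cs) c₀ av (λ v → relabelling-kept cs L)

  isOutside : Label n → ℕ
  isOutside outside = 1
  isOutside _       = 0

  SameOutside : Labelling n → Labelling n → Set
  SameOutside L L′ = ∀ v → isOutside (L′ v) ≡ isOutside (L v)

  inside⇒isOutside≡0 : ∀ {d} → d ≢ outside → isOutside d ≡ 0
  inside⇒isOutside≡0 {outside}  d≢ = contradiction refl d≢
  inside⇒isOutside≡0 {centre}   d≢ = refl
  inside⇒isOutside≡0 {leaf _}   d≢ = refl
  inside⇒isOutside≡0 {knee _ _} d≢ = refl
  inside⇒isOutside≡0 {foot _}   d≢ = refl

  isOutside≢0⇒outside : ∀ {d} → isOutside d ≢ 0 → d ≡ outside
  isOutside≢0⇒outside {outside}  _   = refl
  isOutside≢0⇒outside {centre}   d-out = contradiction refl d-out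
  isOutside≢0⇒outside {leaf _}   d-out = contradiction refl d-out
  isOutside≢0⇒outside {knee _ _} d-out = contradiction refl d-out
  isOutside≢0⇒outside {foot _}   d-out = contradiction refl d-out

  same-outside : ∀ {L} cs →
                 (∀ v → v ∈ changed cs → L v ≢ outside × relabelling cs L v ≢ outside) →
                 SameOutside L (relabelling cs L)
  same-outside {L} cs inside v with v ∈? changed cs
  ... | yes v∈ = trans (inside⇒isOutside≡0 (proj₂ (inside v v∈)))
                       (sym (inside⇒isOutside≡0 (proj₁ (inside v v∈))))
  ... | no v∉  = cong isOutside (relabelling-kept cs L v∉)

  -- A centre c that may have lost its last knee, next to another centre z, is kept if it is
  -- still big; otherwise its spider is absorbed by z: with a single leaf ℓ left, c becomes a
  -- knee of z with foot ℓ, and with nothing left, a leaf of z.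
  repair : ∀ {L c z} → AlmostValid G c L → L c ≡ centre → L z ≡ centre → Adj G c z →
           ∃[ L′ ] Valid G L′ × SameOutside L L′
  repair {L} {c} {z} av@(coh , _) c≡ z≡ c~z with children G L c
  ... | many big = L , almostValid⇒valid G av (λ _ → big) , λ _ → refl
  ... | single ℓ ℓ≡ only-ℓ no-knee =
        L′ , almostValid⇒valid G av′ (⊥-elim ∘ label-≢ L′c λ ()) , same-outside cs inside
    where
    cs : Changes
    cs = (c , knee z ℓ) ∷ (ℓ , foot c) ∷ []
    L′ : Labelling n
    L′ = relabelling cs L
    ℓ≢c : ℓ ≢ c
    ℓ≢c = distinct ℓ≡ c≡ λ ()
    L′c : L′ c ≡ knee z ℓ
    L′c = ≔-hit _ c _
    L′ℓ : L′ ℓ ≡ foot c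
    L′ℓ = trans (≔-miss _ _ ℓ≢c) (≔-hit _ ℓ _)
    L′z : L′ z ≡ centre
    L′z = trans (relabelling-kept cs L λ { (here z≡c) → Adj⇒≢ G c~z (sym z≡c)
                                        ; (there (here z≡ℓ)) → distinct z≡ ℓ≡ (λ ()) z≡ℓ
                                        ; (there (there ())) }) z≡
    into : ∀ v y → Refers (L v) y → y ∈ changed cs → v ∈ changed cs
    into v y r (here refl) with referrer-of-centre G (coh v) c≡ r
    ... | inj₁ v≡ = there (here (only-ℓ v v≡))
    ... | inj₂ (w , v≡) = contradiction v≡ (no-knee v w)
    into v y r (there (here refl)) = contradiction r (no-referrer-of-leaf G (coh v) ℓ≡)
    out : ∀ u y → u ∈ changed cs → Refers (L u) y → y ∈ changed cs ⊎ y ≡ c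
    out u y (here refl)         r = ⊥-elim (refers-via c≡ r)
    out u y (there (here refl)) r = inj₂ (refers-via ℓ≡ r)
    coh′ : ∀ v → v ∈ changed cs → Coherent G L′ v
    coh′ v (here refl) = coherent-at G _ L′c (L′z , c~z , L′ℓ)
    coh′ v (there (here refl)) =
      coherent-at G _ L′ℓ ((z , L′c) , proj₂ (coherent-as G _ (coh ℓ) ℓ≡))
    big′ : ∀ v → v ∈ changed cs → L′ v ≡ centre → Big G L′ v
    big′ v (here refl)         = ⊥-elim ∘ label-≢ L′c λ ()
    big′ v (there (here refl)) = ⊥-elim ∘ label-≢ L′ℓ λ ()
    av′ : AlmostValid G c L′
    av′ = relabelling-almostValid cs c av into out coh′ big′
    inside : ∀ v → v ∈ changed cs → L v ≢ outside × L′ v ≢ outside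
    inside v (here refl)         = label-≢ c≡ (λ ()) , label-≢ L′c (λ ())
    inside v (there (here refl)) = label-≢ ℓ≡ (λ ()) , label-≢ L′ℓ (λ ())
  ... | none no-leaf no-knee =
        L′ , almostValid⇒valid G av′ (⊥-elim ∘ label-≢ L′c λ ()) , same-outside cs inside
    where
    cs : Changes
    cs = (c , leaf z) ∷ []
    L′ : Labelling n
    L′ = relabelling cs L
    L′c : L′ c ≡ leaf z
    L′c = ≔-hit _ c _
    L′z : L′ z ≡ centre
    L′z = trans (relabelling-kept cs L λ { (here z≡c) → Adj⇒≢ G c~z (sym z≡c) ; (there ()) }) z≡
    into : ∀ v y → Refers (L v) y → y ∈ changed cs → v ∈ changed cs
    into v y r (here refl) with referrer-of-centre G (coh v) c≡ r
    ... | inj₁ v≡       = contradiction v≡ (no-leaf v)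
    ... | inj₂ (w , v≡) = contradiction v≡ (no-knee v w)
    out : ∀ u y → u ∈ changed cs → Refers (L u) y → y ∈ changed cs ⊎ y ≡ c
    out u y (here refl) r = ⊥-elim (refers-via c≡ r)
    coh′ : ∀ v → v ∈ changed cs → Coherent G L′ v
    coh′ v (here refl) = coherent-at G _ L′c (L′z , c~z)
    big′ : ∀ v → v ∈ changed cs → L′ v ≡ centre → Big G L′ v
    big′ v (here refl) = ⊥-elim ∘ label-≢ L′c λ ()
    av′ : AlmostValid G c L′
    av′ = relabelling-almostValid cs c av into out coh′ big′
    inside : ∀ v → v ∈ changed cs → L v ≢ outside × L′ v ≢ outside
    inside v (here refl) = label-≢ c≡ (λ ()) , label-≢ L′c (λ ())

  same-outside-except : ∀ {L} x cs →
    (∀ v → v ∈ changed cs → v ≢ x → L v ≢ outside × relabelling cs L v ≢ outside) →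
    ∀ v → v ≢ x → isOutside (relabelling cs L v) ≡ isOutside (L v)
  same-outside-except {L} x cs inside v v≢x with v ∈? changed cs
  ... | yes v∈ = trans (inside⇒isOutside≡0 (proj₂ (inside v v∈ v≢x)))
                       (sym (inside⇒isOutside≡0 (proj₁ (inside v v∈ v≢x))))
  ... | no v∉  = cong isOutside (relabelling-kept cs L v∉)

  record Absorption (L : Labelling n) (x : Fin n) : Set where
    field
      labelling : Labelling n
      valid     : Valid G labelling
      absorbed  : isOutside (labelling x) ≡ 0
      others    : ∀ v → v ≢ x → isOutside (labelling v) ≡ isOutside (L v)

  module _ {L : Labelling n} {x y : Fin n} (valid : Valid G L) (x≡ : L x ≡ outside) (y~x : Adj G y x) where

    private
      coh : ∀ v → Coherent G L v
      coh = proj₁ valid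
      x~y : Adj G x y
      x~y = Adj-sym G y~x

    attach : L y ≡ centre → Absorption L x
    attach y≡ = record
      { labelling = L′
      ; valid     = almostValid⇒valid G
                      (relabelling-almostValid cs x (valid⇒almostValid G x valid) into out coh′ big′)
                      (⊥-elim ∘ label-≢ L′x λ ())
      ; absorbed  = cong isOutside L′x
      ; others    = same-outside-except x cs λ { v (here refl) v≢x → contradiction refl v≢x }
      }
      where
      cs : Changes
      cs = (x , leaf y) ∷ []
      L′ : Labelling n
      L′ = relabelling cs L
      L′x : L′ x ≡ leaf y
      L′x = ≔-hit _ x _
      L′y : L′ y ≡ centre
      L′y = trans (≔-miss _ _ (Adj⇒≢ G y~x)) y≡
      into : ∀ v z → Refers (L v) z → z ∈ changed cs → v ∈ changed cs
      into v z r (here refl) = contradiction r (no-referrer-of-outside G (coh v) x≡)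
      out : ∀ u z → u ∈ changed cs → Refers (L u) z → z ∈ changed cs ⊎ z ≡ x
      out u z (here refl) r = ⊥-elim (refers-via x≡ r)
      coh′ : ∀ v → v ∈ changed cs → Coherent G L′ v
      coh′ v (here refl) = coherent-at G _ L′x (L′y , x~y)
      big′ : ∀ v → v ∈ changed cs → L′ v ≡ centre → Big G L′ v
      big′ v (here refl) = ⊥-elim ∘ label-≢ L′x λ ()

    extend : ∀ {c} → L y ≡ leaf c → Absorption L x
    extend {c} y≡ = record
      { labelling = L′
      ; valid     = almostValid⇒valid G
                      (relabelling-almostValid cs c (valid⇒almostValid G c valid) into out coh′ big′)
                      (λ _ → inj₁ (y , x , L′y))
      ; absorbed  = cong isOutside L′x
      ; others    = same-outside-except x cs inside
      }
      where
      cs : Changes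
      cs = (y , knee c x) ∷ (x , foot y) ∷ []
      L′ : Labelling n
      L′ = relabelling cs L
      x≢y : x ≢ y
      x≢y = Adj⇒≢ G x~y
      L′y : L′ y ≡ knee c x
      L′y = ≔-hit _ y _
      L′x : L′ x ≡ foot y
      L′x = trans (≔-miss _ _ x≢y) (≔-hit _ x _)
      c≡ : L c ≡ centre
      c≡ = proj₁ (coherent-as G _ (coh y) y≡)
      L′c : L′ c ≡ centre
      L′c = trans (relabelling-kept cs L λ { (here refl) → label-≢ c≡ (λ ()) y≡
                                           ; (there (here refl)) → label-≢ c≡ (λ ()) x≡
                                           ; (there (there ())) }) c≡
      into : ∀ v z → Refers (L v) z → z ∈ changed cs → v ∈ changed cs
      into v z r (here refl)         = contradiction r (no-referrer-of-leaf G (coh v) y≡)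
      into v z r (there (here refl)) = contradiction r (no-referrer-of-outside G (coh v) x≡)
      out : ∀ u z → u ∈ changed cs → Refers (L u) z → z ∈ changed cs ⊎ z ≡ c
      out u z (here refl)         r = inj₂ (refers-via y≡ r)
      out u z (there (here refl)) r = ⊥-elim (refers-via x≡ r)
      coh′ : ∀ v → v ∈ changed cs → Coherent G L′ v
      coh′ v (here refl)         =
        coherent-at G _ L′y (L′c , proj₂ (coherent-as G _ (coh y) y≡) , L′x)
      coh′ v (there (here refl)) = coherent-at G _ L′x ((c , L′y) , x~y)
      big′ : ∀ v → v ∈ changed cs → L′ v ≡ centre → Big G L′ v
      big′ v (here refl)         = ⊥-elim ∘ label-≢ L′y λ ()
      big′ v (there (here refl)) = ⊥-elim ∘ label-≢ L′x λ ()
      inside : ∀ v → v ∈ changed cs → v ≢ x → L v ≢ outside × L′ v ≢ outside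
      inside v (here refl)         _   = label-≢ y≡ (λ ()) , label-≢ L′y (λ ())
      inside v (there (here refl)) v≢x = contradiction refl v≢x

    absorb-by-repair : ∀ {L′ c z} → AlmostValid G c L′ → L′ c ≡ centre → L′ z ≡ centre →
                       Adj G c z → isOutside (L′ x) ≡ 0 →
                       (∀ v → v ≢ x → isOutside (L′ v) ≡ isOutside (L v)) → Absorption L x
    absorb-by-repair av c≡ z≡ c~z x-in others with repair av c≡ z≡ c~z
    ... | L″ , valid″ , same = record
      { labelling = L″
      ; valid     = valid″
      ; absorbed  = trans (same x) x-in
      ; others    = λ v v≢x → trans (same v) (others v v≢x)
      }

    -- A knee y (in split-foot the knee u above the foot y) becomes a new centre, which may
    -- leave its old centre c too small.
    split-knee : ∀ {c w} → L y ≡ knee c w → Absorption L x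
    split-knee {c} {w} y≡ =
      absorb-by-repair (relabelling-almostValid cs c (valid⇒almostValid G c valid) into out coh′ big′)
               L′c L′y (Adj-sym G y~c) (cong isOutside L′x) (same-outside-except x cs inside)
      where
      cs : Changes
      cs = (y , centre) ∷ (x , leaf y) ∷ (w , leaf y) ∷ []
      L′ : Labelling n
      L′ = relabelling cs L
      c≡ : L c ≡ centre
      c≡ = proj₁ (coherent-as G _ (coh y) y≡)
      y~c : Adj G y c
      y~c = proj₁ (proj₂ (coherent-as G _ (coh y) y≡))
      w≡ : L w ≡ foot y
      w≡ = proj₂ (proj₂ (coherent-as G _ (coh y) y≡))
      x≢y : x ≢ y
      x≢y = Adj⇒≢ G x~y
      w≢y : w ≢ y
      w≢y = distinct w≡ y≡ λ ()
      w≢x : w ≢ x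
      w≢x = distinct w≡ x≡ λ ()
      L′y : L′ y ≡ centre
      L′y = ≔-hit _ y _
      L′x : L′ x ≡ leaf y
      L′x = trans (≔-miss _ _ x≢y) (≔-hit _ x _)
      L′w : L′ w ≡ leaf y
      L′w = trans (≔-miss _ _ w≢y) (trans (≔-miss _ _ w≢x) (≔-hit _ w _))
      L′c : L′ c ≡ centre
      L′c = trans (relabelling-kept cs L λ { (here refl) → label-≢ c≡ (λ ()) y≡
                                           ; (there (here refl)) → label-≢ c≡ (λ ()) x≡
                                           ; (there (there (here refl))) → label-≢ c≡ (λ ()) w≡
                                           ; (there (there (there ()))) }) c≡
      into : ∀ v z → Refers (L v) z → z ∈ changed cs → v ∈ changed cs
      into v z r (here refl)                 = there (there (here (referrer-of-knee G (coh v) y≡ r)))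
      into v z r (there (here refl))         = contradiction r (no-referrer-of-outside G (coh v) x≡)
      into v z r (there (there (here refl))) = here (referrer-of-foot G (coh v) w≡ r)
      out : ∀ u z → u ∈ changed cs → Refers (L u) z → z ∈ changed cs ⊎ z ≡ c
      out u z (here refl) r with refers-via y≡ r
      ... | inj₁ z≡c = inj₂ z≡c
      ... | inj₂ z≡w = inj₁ (there (there (here z≡w)))
      out u z (there (here refl))         r = ⊥-elim (refers-via x≡ r)
      out u z (there (there (here refl))) r = inj₁ (here (refers-via w≡ r))
      coh′ : ∀ v → v ∈ changed cs → Coherent G L′ v
      coh′ v (here refl)                 = coherent-at G _ L′y _
      coh′ v (there (here refl))         = coherent-at G _ L′x (L′y , x~y)
      coh′ v (there (there (here refl))) =
        coherent-at G _ L′w (L′y , proj₂ (coherent-as G _ (coh w) w≡))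
      big′ : ∀ v → v ∈ changed cs → L′ v ≡ centre → Big G L′ v
      big′ v (here refl)                 _ = inj₂ (x , w , w≢x ∘ sym , L′x , L′w)
      big′ v (there (here refl))           = ⊥-elim ∘ label-≢ L′x λ ()
      big′ v (there (there (here refl)))   = ⊥-elim ∘ label-≢ L′w λ ()
      inside : ∀ v → v ∈ changed cs → v ≢ x → L v ≢ outside × L′ v ≢ outside
      inside v (here refl)                 _   = label-≢ y≡ (λ ()) , label-≢ L′y (λ ())
      inside v (there (here refl))         v≢x = contradiction refl v≢x
      inside v (there (there (here refl))) _   = label-≢ w≡ (λ ()) , label-≢ L′w (λ ())

    split-foot : ∀ {u} → L y ≡ foot u → Absorption L x
    split-foot {u} y≡ with coherent-as G _ (coh y) y≡
    ... | (c , u≡) , y~u =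
      absorb-by-repair (relabelling-almostValid cs c (valid⇒almostValid G c valid) into out coh′ big′)
               L′c L′u (Adj-sym G u~c) (cong isOutside L′x) (same-outside-except x cs inside)
      where
      cs : Changes
      cs = (u , centre) ∷ (y , knee u x) ∷ (x , foot y) ∷ []
      L′ : Labelling n
      L′ = relabelling cs L
      c≡ : L c ≡ centre
      c≡ = proj₁ (coherent-as G _ (coh u) u≡)
      u~c : Adj G u c
      u~c = proj₁ (proj₂ (coherent-as G _ (coh u) u≡))
      x≢y : x ≢ y
      x≢y = Adj⇒≢ G x~y
      y≢u : y ≢ u
      y≢u = Adj⇒≢ G y~u
      x≢u : x ≢ u
      x≢u = distinct x≡ u≡ λ ()
      L′u : L′ u ≡ centre
      L′u = ≔-hit _ u _
      L′y : L′ y ≡ knee u x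
      L′y = trans (≔-miss _ _ y≢u) (≔-hit _ y _)
      L′x : L′ x ≡ foot y
      L′x = trans (≔-miss _ _ x≢u) (trans (≔-miss _ _ x≢y) (≔-hit _ x _))
      L′c : L′ c ≡ centre
      L′c = trans (relabelling-kept cs L λ { (here refl) → label-≢ c≡ (λ ()) u≡
                                           ; (there (here refl)) → label-≢ c≡ (λ ()) y≡
                                           ; (there (there (here refl))) → label-≢ c≡ (λ ()) x≡
                                           ; (there (there (there ()))) }) c≡
      into : ∀ v z → Refers (L v) z → z ∈ changed cs → v ∈ changed cs
      into v z r (here refl)                 = there (here (referrer-of-knee G (coh v) u≡ r))
      into v z r (there (here refl))         = here (referrer-of-foot G (coh v) y≡ r)
      into v z r (there (there (here refl))) = contradiction r (no-referrer-of-outside G (coh v) x≡)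
      out : ∀ v z → v ∈ changed cs → Refers (L v) z → z ∈ changed cs ⊎ z ≡ c
      out v z (here refl) r with refers-via u≡ r
      ... | inj₁ z≡c = inj₂ z≡c
      ... | inj₂ z≡y = inj₁ (there (here z≡y))
      out v z (there (here refl))         r = inj₁ (here (refers-via y≡ r))
      out v z (there (there (here refl))) r = ⊥-elim (refers-via x≡ r)
      coh′ : ∀ v → v ∈ changed cs → Coherent G L′ v
      coh′ v (here refl)                 = coherent-at G _ L′u _
      coh′ v (there (here refl))         = coherent-at G _ L′y (L′u , y~u , L′x)
      coh′ v (there (there (here refl))) = coherent-at G _ L′x ((u , L′y) , x~y)
      big′ : ∀ v → v ∈ changed cs → L′ v ≡ centre → Big G L′ v
      big′ v (here refl)                 _ = inj₁ (y , x , L′y)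
      big′ v (there (here refl))           = ⊥-elim ∘ label-≢ L′y λ ()
      big′ v (there (there (here refl)))   = ⊥-elim ∘ label-≢ L′x λ ()
      inside : ∀ v → v ∈ changed cs → v ≢ x → L v ≢ outside × L′ v ≢ outside
      inside v (here refl)                 _   = label-≢ u≡ (λ ()) , label-≢ L′u (λ ())
      inside v (there (here refl))         _   = label-≢ y≡ (λ ()) , label-≢ L′y (λ ())
      inside v (there (there (here refl))) v≢x = contradiction refl v≢x

    absorb : isOutside (L y) ≡ 0 → Absorption L x
    absorb y-in with L y in y≡
    absorb () | outside
    ... | centre   = attach y≡
    ... | leaf _   = extend y≡
    ... | knee _ _ = split-knee y≡
    ... | foot _   = split-foot y≡

  outsiders : Labelling n → ℕ
  outsiders L = sum (λ v → isOutside (L v))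

  outsiders-absorption : ∀ {L x} → L x ≡ outside → (A : Absorption L x) →
                         outsiders L ≡ suc (outsiders (Absorption.labelling A))
  outsiders-absorption {L} {x} x≡ A = begin
    sum (λ v → isOutside (L v))                    ≡⟨ sum-cong-≗ split ⟩
    sum (λ v → isOutside (L′ v) + when (x ≟ v) 1)  ≡⟨ ∑-distrib-+ (λ v → isOutside (L′ v)) _ ⟩
    outsiders L′ + sum (λ v → when (x ≟ v) 1)      ≡⟨ cong (outsiders L′ +_) (sum-point x (λ _ → 1)) ⟩
    outsiders L′ + 1                               ≡⟨ +-comm (outsiders L′) 1 ⟩
    suc (outsiders L′)                             ∎
    where
    open ≡-Reasoning
    open Absorption A renaming (labelling to L′)
    split : ∀ v → isOutside (L v) ≡ isOutside (L′ v) + when (x ≟ v) 1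
    split v with x ≟ v
    ... | yes refl = trans (cong isOutside x≡) (cong (_+ 1) (sym absorbed))
    ... | no x≢v   = trans (sym (others v (x≢v ∘ sym))) (sym (+-identityʳ _))

  record SpiderCover : Set where
    field
      labelling : Labelling n
      coherent  : ∀ v → Coherent G labelling v
      big       : ∀ c → labelling c ≡ centre → Big G labelling c
      covered   : ∀ v → labelling v ≢ outside

  module _ (connected : Connected G) where

    grow : ∀ t {L} → Valid G L → ∀ {a} → isOutside (L a) ≡ 0 → outsiders L ≡ t → SpiderCover
    grow zero {L} (coh , big) _ none-outside = record
      { labelling = L ; coherent = coh ; big = big
      ; covered   = λ v v≡ → contradiction (subst₂ _≤_ (cong isOutside v≡) none-outside
                                                   (point≤sum (λ v → isOutside (L v)) v)) λ ()
      }
    grow (suc t) {L} valid {a} a-in outsiders≡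
      with sum-positive (λ v → isOutside (L v)) (subst (0 <_) (sym outsiders≡) (s≤s z≤n))
    ... | z , z-out
      with walk-crosses G (λ v → isOutside (L v) ℕ.≟ 0) (connected a z) a-in (<⇒≢ z-out ∘ sym)
    ... | x , y , x-out , y-in , y~x =
      grow t (Absorption.valid A) (trans (Absorption.others A a a≢x) a-in)
             (suc-injective (trans (sym (outsiders-absorption x≡ A)) outsiders≡))
      where
      x≡ : L x ≡ outside
      x≡ = isOutside≢0⇒outside x-out
      A : Absorption L x
      A = absorb valid x≡ y~x y-in
      a≢x : a ≢ x
      a≢x refl = x-out a-in

    star : ∀ {c l l′} → Adj G c l → Adj G c l′ → l ≢ l′ → SpiderCover
    star {c} {l} {l′} c~l c~l′ l≢l′ = grow _ valid′ (cong isOutside L′c) refl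
      where
      cs : Changes
      cs = (c , centre) ∷ (l , leaf c) ∷ (l′ , leaf c) ∷ []
      L′ : Labelling n
      L′ = relabelling cs (λ _ → outside)
      l≢c : l ≢ c
      l≢c = Adj⇒≢ G (Adj-sym G c~l)
      l′≢c : l′ ≢ c
      l′≢c = Adj⇒≢ G (Adj-sym G c~l′)
      L′c : L′ c ≡ centre
      L′c = ≔-hit _ c _
      L′l : L′ l ≡ leaf c
      L′l = trans (≔-miss _ _ l≢c) (≔-hit _ l _)
      L′l′ : L′ l′ ≡ leaf c
      L′l′ = trans (≔-miss _ _ l′≢c) (trans (≔-miss _ _ (l≢l′ ∘ sym)) (≔-hit _ l′ _))
      coh′ : ∀ v → v ∈ changed cs → Coherent G L′ v
      coh′ v (here refl)                 = coherent-at G _ L′c _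
      coh′ v (there (here refl))         = coherent-at G _ L′l (L′c , Adj-sym G c~l)
      coh′ v (there (there (here refl))) = coherent-at G _ L′l′ (L′c , Adj-sym G c~l′)
      big′ : ∀ v → v ∈ changed cs → L′ v ≡ centre → Big G L′ v
      big′ v (here refl)                 _ = inj₂ (l , l′ , l≢l′ , L′l , L′l′)
      big′ v (there (here refl))           = ⊥-elim ∘ label-≢ L′l λ ()
      big′ v (there (there (here refl)))   = ⊥-elim ∘ label-≢ L′l′ λ ()
      valid′ : Valid G L′
      valid′ = almostValid⇒valid G
        (relabelling-almostValid cs l ((λ _ → tt) , λ _ _ ()) (λ _ _ ()) (λ _ _ _ ()) coh′ big′)
        (⊥-elim ∘ label-≢ L′l λ ())

    spider-cover : ∀ {v₀ v₁ v₂ : Fin n} → v₀ ≢ v₁ → v₀ ≢ v₂ → v₁ ≢ v₂ → SpiderCover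
    spider-cover {v₀} {v₁} {v₂} v₀≢v₁ v₀≢v₂ v₁≢v₂
      with walk-crosses G (_≟ v₀) (connected v₀ v₁) refl (v₀≢v₁ ∘ sym)
    ... | b , _ , b≢v₀ , refl , v₀~b
      with another-vertex v₀≢v₁ v₀≢v₂ v₁≢v₂ b
    ... | z , z≢v₀ , z≢b
      with walk-crosses G (λ v → (v ≟ v₀) ⊎-dec (v ≟ b)) (connected v₀ z) (inj₁ refl)
                        [ z≢v₀ , z≢b ]
    ... | x , _ , x∉ , inj₁ refl , v₀~x = star v₀~b v₀~x (λ b≡x → x∉ (inj₂ (sym b≡x)))
    ... | x , _ , x∉ , inj₂ refl , b~x  =
      star (Adj-sym G v₀~b) b~x (λ v₀≡x → x∉ (inj₁ (sym v₀≡x)))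

-- Weighting the spiders of a cover

record Weights : Set where
  constructor ⟨_,_,_,_⟩
  field
    atCentre atLeaf atKnee atFoot : ℕ
open Weights

weightOf : ∀ {n} → Weights → Label n → ℕ
weightOf W outside    = 0
weightOf W centre     = atCentre W
weightOf W (leaf _)   = atLeaf W
weightOf W (knee _ _) = atKnee W
weightOf W (foot _)   = atFoot W

spiderSum : Weights → ℕ → ℕ → ℕ
spiderSum W A B = atCentre W + atLeaf W * A + (atKnee W + atFoot W) * B

spiderSum-expand : ∀ W A B →
                   atCentre W + atLeaf W * A + atKnee W * B + atFoot W * B ≡ spiderSum W A B
spiderSum-expand W A B =
  trans (+-assoc (atCentre W + atLeaf W * A) (atKnee W * B) (atFoot W * B))
        (cong (atCentre W + atLeaf W * A +_) (sym (*-distribʳ-+ B (atKnee W) (atFoot W))))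

AllAtMost : ℕ → Weights → Set
AllAtMost m W = atCentre W ≤ m × atLeaf W ≤ m × atKnee W ≤ m × atFoot W ≤ m

weightOf-≤ : ∀ {n m W} → AllAtMost m W → (d : Label n) → weightOf W d ≤ m
weightOf-≤ _                   outside    = z≤n
weightOf-≤ (c≤ , _ , _ , _)    centre     = c≤
weightOf-≤ (_ , l≤ , _ , _)    (leaf _)   = l≤
weightOf-≤ (_ , _ , k≤ , _)    (knee _ _) = k≤
weightOf-≤ (_ , _ , _ , f≤)    (foot _)   = f≤

uniform : ℕ → Weights
uniform p = ⟨ p , p , p , p ⟩

data Pattern : Set where
  hub spread kneeHubs halves : Pattern

halves? : (P : Pattern) → Dec (P ≡ halves)
halves? halves   = yes refl
halves? hub      = no λ ()
halves? spread   = no λ ()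
halves? kneeHubs = no λ ()

weights : (k h s : ℕ) → Pattern → Weights
weights k h s hub      = ⟨ k , 0 , 0 , h ⟩
weights k h s spread   = ⟨ s , h , 0 , s ⟩
weights k h s kneeHubs = ⟨ 0 , h , k , 0 ⟩
weights k h s halves   = ⟨ h , h , 0 , h ⟩

module Spiders {n} {G : SimpleGraph n} (L : Labelling n)
               (coherent : ∀ v → Coherent G L v) (covered : ∀ v → L v ≢ outside) where

  parentOf : Fin n → Label n → Fin n
  parentOf v (leaf c)   = c
  parentOf v (knee c _) = c
  parentOf v (foot u)   = u
  parentOf v outside    = v
  parentOf v centre     = v

  up : Fin n → Fin n
  up v = parentOf v (L v)

  -- The centre of the spider containing v: a centre is its own parent.
  home : Fin n → Fin n
  home v = up (up v)

  up-centre : ∀ {v} → L v ≡ centre → up v ≡ v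
  up-centre {v} v≡ = cong (parentOf v) v≡

  home-centre : ∀ {v} → L v ≡ centre → home v ≡ v
  home-centre v≡ = trans (cong up (up-centre v≡)) (up-centre v≡)

  home-leaf : ∀ {v c} → L v ≡ leaf c → home v ≡ c
  home-leaf {v} v≡ =
    trans (cong up (cong (parentOf v) v≡)) (up-centre (proj₁ (coherent-as G _ (coherent v) v≡)))

  home-knee : ∀ {v c w} → L v ≡ knee c w → home v ≡ c
  home-knee {v} v≡ =
    trans (cong up (cong (parentOf v) v≡)) (up-centre (proj₁ (coherent-as G _ (coherent v) v≡)))

  home-foot : ∀ {v u c w} → L v ≡ foot u → L u ≡ knee c w → home v ≡ c
  home-foot {v} {u} v≡ u≡ = trans (cong up (cong (parentOf v) v≡)) (cong (parentOf u) u≡)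

  home-is-centre : ∀ v → L (home v) ≡ centre
  home-is-centre v = by-label (L v) refl (coherent v)
    where
    by-label : ∀ d → L v ≡ d → CoherentAt G L v d → L (home v) ≡ centre
    by-label outside    v≡ _              = contradiction v≡ (covered v)
    by-label centre     v≡ _              = subst (λ h → L h ≡ centre) (sym (home-centre v≡)) v≡
    by-label (leaf c)   v≡ (c≡ , _)       = subst (λ h → L h ≡ centre) (sym (home-leaf v≡)) c≡
    by-label (knee c w) v≡ (c≡ , _)       = subst (λ h → L h ≡ centre) (sym (home-knee v≡)) c≡
    by-label (foot u)   v≡ ((c , u≡) , _) =
      subst (λ h → L h ≡ centre) (sym (home-foot v≡ u≡)) (proj₁ (coherent-as G _ (coherent u) u≡))

  fibre : Fin n → (Fin n → ℕ) → ℕ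
  fibre c g = sum (λ v → when (home v ≟ c) (g v))

  FootIn : Fin n → Label n → Set
  FootIn c d = ∃₂ λ u w → d ≡ foot u × L u ≡ knee c w

  footIn? : ∀ c d → Dec (FootIn c d)
  footIn? c (foot u) with knee? c (L u)
  ... | yes (w , u≡) = yes (u , w , refl , u≡)
  ... | no ¬knee     = no λ { (_ , w , refl , u≡) → ¬knee (w , u≡) }
  footIn? c outside    = no λ { (_ , _ , () , _) }
  footIn? c centre     = no λ { (_ , _ , () , _) }
  footIn? c (leaf _)   = no λ { (_ , _ , () , _) }
  footIn? c (knee _ _) = no λ { (_ , _ , () , _) }

  leaves knees feet : Fin n → ℕ
  leaves c = count (λ v → leaf? c (L v))
  knees  c = count (λ v → knee? c (L v))
  feet   c = count (λ v → footIn? c (L v))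

  footOf : Fin n → Fin n
  footOf u with L u
  ... | knee _ w = w
  ... | _        = u

  feet≡knees : ∀ c → feet c ≡ knees c
  feet≡knees c = count-bijection (λ v → footIn? c (L v)) (λ v → knee? c (L v)) up footOf
    (λ { {v} (u , w , v≡ , u≡) → w , subst (λ x → L x ≡ knee c w) (sym (cong (parentOf v) v≡)) u≡ })
    (λ { {u} (w , u≡) → subst (λ x → FootIn c (L x)) (sym (footOf-knee u≡)) (u , w , foot≡ u≡ , u≡) })
    (λ { {v} (u , w , v≡ , u≡) → trans (cong footOf (cong (parentOf v) v≡))
                                       (trans (footOf-knee u≡) (sym (knee-foot v≡ u≡))) })
    (λ { {u} (w , u≡) → trans (cong up (footOf-knee u≡)) (cong (parentOf w) (foot≡ u≡)) })
    where
    footOf-knee : ∀ {u c w} → L u ≡ knee c w → footOf u ≡ w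
    footOf-knee {u} u≡ with L u
    footOf-knee refl | knee _ _ = refl
    foot≡ : ∀ {u c w} → L u ≡ knee c w → L w ≡ foot u
    foot≡ {u} u≡ = proj₂ (proj₂ (coherent-as G _ (coherent u) u≡))
    knee-foot : ∀ {v u c w} → L v ≡ foot u → L u ≡ knee c w → v ≡ w
    knee-foot {v} v≡ u≡ with coherent-as G _ (coherent v) v≡
    ... | (_ , u≡′) , _ with trans (sym u≡) u≡′
    ...   | refl = refl

  byRole : Weights → Fin n → Fin n → Label n → ℕ
  byRole W c v d = when (c ≟ v) (atCentre W) + when (leaf? c d) (atLeaf W)
                 + when (knee? c d) (atKnee W) + when (footIn? c d) (atFoot W)

  fibre-split : ∀ W {c} → L c ≡ centre → ∀ v → when (home v ≟ c) (weightOf W (L v)) ≡ byRole W c v (L v)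
  fibre-split W {c} c≡ v = by-label (L v) refl (coherent v)
    where
    ≢c : ∀ {d} → L v ≡ d → d ≢ centre → c ≢ v
    ≢c v≡ d≢ refl = d≢ (trans (sym v≡) c≡)
    by-label : ∀ d → L v ≡ d → CoherentAt G L v d → when (home v ≟ c) (weightOf W d) ≡ byRole W c v d
    by-label outside v≡ _ = contradiction v≡ (covered v)
    by-label centre v≡ _ rewrite home-centre v≡ =
      trans (when-sym v c _) (sym (trans (+-identityʳ _) (trans (+-identityʳ _) (+-identityʳ _))))
    by-label (leaf c′) v≡ _ rewrite home-leaf v≡ | when-no (c ≟ v) {atCentre W} (≢c v≡ λ ())
      with c′ ≟ c
    ... | yes refl = sym (trans (+-identityʳ _) (+-identityʳ _))
    ... | no _     = refl
    by-label (knee c′ w) v≡ _ rewrite home-knee v≡ | when-no (c ≟ v) {atCentre W} (≢c v≡ λ ())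
      with c′ ≟ c
    ... | yes refl = sym (+-identityʳ _)
    ... | no _     = refl
    by-label (foot u) v≡ ((c′ , u≡) , _)
      rewrite home-foot v≡ u≡ | when-no (c ≟ v) {atCentre W} (≢c v≡ λ ())
      with knee? c (L u)
    ... | yes (_ , u≡′) = when-yes (c′ ≟ c) (knee-injectiveˡ (trans (sym u≡) u≡′))
    ... | no ¬knee      = when-no (c′ ≟ c) λ { refl → ¬knee (v , u≡) }

  fibre-weight : ∀ W {c} → L c ≡ centre →
                 fibre c (λ v → weightOf W (L v)) ≡ spiderSum W (leaves c) (knees c)
  fibre-weight W {c} c≡ = begin
    fibre c (λ v → weightOf W (L v))            ≡⟨ sum-cong-≗ (fibre-split W c≡) ⟩
    sum (λ v → ctr v + lf v + kn v + ft v)      ≡⟨ ∑-distrib-+ (λ v → ctr v + lf v + kn v) ft ⟩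
    sum (λ v → ctr v + lf v + kn v) + sum ft    ≡⟨ cong (_+ sum ft) (∑-distrib-+ (λ v → ctr v + lf v) kn) ⟩
    sum (λ v → ctr v + lf v) + sum kn + sum ft  ≡⟨ cong (λ x → x + sum kn + sum ft) (∑-distrib-+ ctr lf) ⟩
    sum ctr + sum lf + sum kn + sum ft
      ≡⟨ cong₂ _+_ (cong₂ _+_ (cong₂ _+_ (sum-point c (λ _ → atCentre W))
                                          (sum-when (λ v → leaf? c (L v)) (atLeaf W)))
                               (sum-when (λ v → knee? c (L v)) (atKnee W)))
                   (trans (sum-when (λ v → footIn? c (L v)) (atFoot W))
                          (cong (atFoot W *_) (feet≡knees c))) ⟩
    atCentre W + atLeaf W * leaves c + atKnee W * knees c + atFoot W * knees c
      ≡⟨ spiderSum-expand W (leaves c) (knees c) ⟩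
    spiderSum W (leaves c) (knees c)            ∎
    where
    open ≡-Reasoning
    ctr lf kn ft : Fin n → ℕ
    ctr v = when (c ≟ v) (atCentre W)
    lf  v = when (leaf? c (L v)) (atLeaf W)
    kn  v = when (knee? c (L v)) (atKnee W)
    ft  v = when (footIn? c (L v)) (atFoot W)

  fibre-empty : ∀ {c} g → L c ≢ centre → fibre c g ≡ 0
  fibre-empty {c} g c≢ =
    trans (sum-cong-≗ λ v → when-no (home v ≟ c) λ { refl → c≢ (home-is-centre v) })
          (sum-replicate-zero n)

  fibre-cong : ∀ c {g g′ : Fin n → ℕ} → (∀ v → home v ≡ c → g v ≡ g′ v) → fibre c g ≡ fibre c g′
  fibre-cong c {g} {g′} g≗g′ = sum-cong-≗ λ v → pointwise v (home v ≟ c)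
    where
    pointwise : ∀ v (d : Dec (home v ≡ c)) → when d (g v) ≡ when d (g′ v)
    pointwise v (yes e) = g≗g′ v e
    pointwise v (no _)  = refl

  weight-bound : ∀ (W : Fin n → Weights) q p →
    (∀ c → L c ≡ centre →
           q * spiderSum (W c) (leaves c) (knees c) ≤ spiderSum (uniform p) (leaves c) (knees c)) →
    q * sum (λ v → weightOf (W (home v)) (L v)) ≤ p * n
  weight-bound W q p per-spider = begin
    q * sum f                        ≡⟨ cong (q *_) (sum-fibres home f) ⟩
    q * sum (λ c → fibre c f)        ≡⟨ *-distribˡ-sum q (λ c → fibre c f) ⟩
    sum (λ c → q * fibre c f)        ≤⟨ sum-mono-≤ per-fibre ⟩
    sum (λ c → fibre c (λ _ → p))    ≡⟨ sym (sum-fibres home (λ _ → p)) ⟩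
    sum {n} (λ _ → p)                ≡⟨ sum-const n p ⟩
    p * n                            ∎
    where
    open ≤-Reasoning
    f : Fin n → ℕ
    f v = weightOf (W (home v)) (L v)
    per-fibre : ∀ c → q * fibre c f ≤ fibre c (λ _ → p)
    per-fibre c with centre? (L c)
    ... | no c≢ = subst₂ _≤_ (sym (cong (q *_) (fibre-empty f c≢))) (sym (fibre-empty _ c≢))
                             (≤-reflexive (*-zeroʳ q))
    ... | yes c≡ = begin
      q * fibre c f
        ≡⟨ cong (q *_) (fibre-cong c λ v e → cong (λ h → weightOf (W h) (L v)) e) ⟩
      q * fibre c (λ v → weightOf (W c) (L v))         ≡⟨ cong (q *_) (fibre-weight (W c) c≡) ⟩
      q * spiderSum (W c) (leaves c) (knees c)         ≤⟨ per-spider c c≡ ⟩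
      spiderSum (uniform p) (leaves c) (knees c)       ≡⟨ sym (fibre-weight (uniform p) c≡) ⟩
      fibre c (λ v → weightOf (uniform p) (L v))       ≡⟨ fibre-cong c (λ v _ → uniform-inside (covered v)) ⟩
      fibre c (λ _ → p)                                ∎
      where
      uniform-inside : ∀ {d : Label n} → d ≢ outside → weightOf (uniform p) d ≡ p
      uniform-inside {outside}  d≢ = contradiction refl d≢
      uniform-inside {centre}   _  = refl
      uniform-inside {leaf _}   _  = refl
      uniform-inside {knee _ _} _  = refl
      uniform-inside {foot _}   _  = refl

  Big⇒2≤leaves⊎0<knees : ∀ {c} → Big G L c → 2 ≤ leaves c ⊎ 0 < knees c
  Big⇒2≤leaves⊎0<knees {c} (inj₁ (u , w , u≡)) =
    inj₂ (subst (_≤ knees c) (when-yes (knee? c (L u)) (w , u≡))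
                (point≤sum (λ v → when (knee? c (L v)) 1) u))
  Big⇒2≤leaves⊎0<knees {c} (inj₂ (l , l′ , l≢l′ , l≡ , l′≡)) =
    inj₁ (subst (_≤ leaves c) (cong₂ _+_ (when-yes (leaf? c (L l)) l≡) (when-yes (leaf? c (L l′)) l′≡))
                (pair≤sum (λ v → when (leaf? c (L v)) 1) l≢l′))

  knee-child : ∀ c → 0 < knees c → ∃₂ λ v w → L v ≡ knee c w
  knee-child c pos with sum-positive (λ v → when (knee? c (L v)) 1) pos
  ... | v , pos′ with knee? c (L v)
  ...   | yes (w , v≡) = v , w , v≡

  module Valuation (k h s : ℕ) (choose : ℕ → ℕ → Pattern) where

    patternAt : Fin n → Pattern
    patternAt c = choose (leaves c) (knees c)

    f : Fin n → ℕ
    f v = weightOf (weights k h s (patternAt (home v))) (L v)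

    f-at : ∀ {v c d} → home v ≡ c → L v ≡ d → f v ≡ weightOf (weights k h s (patternAt c)) d
    f-at home≡ v≡ = cong₂ (λ c d → weightOf (weights k h s (patternAt c)) d) home≡ v≡

    f-bounded : h ≤ k → s ≤ k → ∀ v → f v ≤ k
    f-bounded h≤k s≤k v = weightOf-≤ (bounded (patternAt (home v))) (L v)
      where
      bounded : ∀ P → AllAtMost k (weights k h s P)
      bounded hub      = ≤-refl , z≤n , z≤n , h≤k
      bounded spread   = s≤k , h≤k , z≤n , s≤k
      bounded kneeHubs = z≤n , h≤k , ≤-refl , z≤n
      bounded halves   = h≤k , h≤k , z≤n , h≤k

    module Dominating (1≤k : 1 ≤ k) (k≤2h : k ≤ 2 * h) (k<2s : k < 2 * s)
                      (kneeHubs⇒knee : ∀ A B → choose A B ≡ kneeHubs → 0 < B) where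

      k<2k : k < 2 * k
      k<2k = subst (k <_) (cong (k +_) (sym (+-identityʳ k))) (m<n+m k 1≤k)

      k≤s+s : k ≤ s + s
      k≤s+s = subst (k ≤_) (cong (s +_) (+-identityʳ s)) (<⇒≤ k<2s)

      k≤h+h : k ≤ h + h
      k≤h+h = subst (k ≤_) (cong (h +_) (+-identityʳ h)) k≤2h

      module _ (u : Fin n) {P} (P≡ : patternAt (home u) ≡ P) where

        value : ∀ {v d} → home v ≡ home u → L v ≡ d → f v ≡ weightOf (weights k h s P) d
        value {d = d} home≡ v≡ = trans (f-at home≡ v≡) (cong (λ Q → weightOf (weights k h s Q) d) P≡)

        self-sufficient : ∀ {d} → L u ≡ d → k ≤ 2 * weightOf (weights k h s P) d → ¬ 2 * f u < k
        self-sufficient u≡ k≤2fu 2fu<k = <⇒≱ (subst (λ y → 2 * y < k) (value refl u≡) 2fu<k) k≤2fu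

        dominated-by-hub : ∀ {v d} → Adj G u v → home v ≡ home u → L v ≡ d →
                           weightOf (weights k h s P) d ≡ k → k ≤ f u + strongNbSum k G f u
        dominated-by-hub {v} u~v home≡ v≡ k≡ =
          ≤-trans (subst (_≤ strongNbSum k G f u) fv≡ (strongNbSum-neighbour G f u u~v k<2fv))
                  (m≤n+m _ (f u))
          where
          fv≡ : f v ≡ k
          fv≡ = trans (value home≡ v≡) k≡
          k<2fv : k < 2 * f v
          k<2fv = subst (λ y → k < 2 * y) (sym fv≡) k<2k

        dominated-by-pair : ∀ {v w d e} → Adj G u v → Adj G u w → v ≢ w →
                            home v ≡ home u → home w ≡ home u → L v ≡ d → L w ≡ e →
                            weightOf (weights k h s P) d ≡ s → weightOf (weights k h s P) e ≡ s →
                            k ≤ f u + strongNbSum k G f u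
        dominated-by-pair {v} {w} u~v u~w v≢w home≡ home≡′ v≡ w≡ s≡ s≡′ =
          ≤-trans (≤-trans k≤s+s
                           (subst (_≤ strongNbSum k G f u) (cong₂ _+_ fv≡ fw≡)
                                  (strongNbSum-neighbours G f u u~v u~w v≢w (strong fv≡) (strong fw≡))))
                  (m≤n+m _ (f u))
          where
          fv≡ : f v ≡ s
          fv≡ = trans (value home≡ v≡) s≡
          fw≡ : f w ≡ s
          fw≡ = trans (value home≡′ w≡) s≡′
          strong : ∀ {x} → f x ≡ s → k < 2 * f x
          strong fx≡ = subst (λ y → k < 2 * y) (sym fx≡) k<2s

      strongly-dominated : ∀ u → patternAt (home u) ≢ halves → 2 * f u < k →
                           k ≤ f u + strongNbSum k G f u
      strongly-dominated u ≢halves 2fu<k = by-label (L u) refl (coherent u) (patternAt (home u)) refl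
        where
        by-label : ∀ d → L u ≡ d → CoherentAt G L u d → ∀ P → patternAt (home u) ≡ P →
                   k ≤ f u + strongNbSum k G f u
        by-label outside    u≡ _ _ _ = contradiction u≡ (covered u)
        by-label _          _  _ halves P≡ = contradiction P≡ ≢halves
        by-label centre     u≡ _ hub      P≡ = contradiction 2fu<k (self-sufficient u P≡ u≡ (<⇒≤ k<2k))
        by-label centre     u≡ _ spread   P≡ = contradiction 2fu<k (self-sufficient u P≡ u≡ (<⇒≤ k<2s))
        by-label centre     u≡ _ kneeHubs P≡
          with knee-child u (kneeHubs⇒knee _ _ (subst (λ c → patternAt c ≡ kneeHubs) (home-centre u≡) P≡))
        ... | v , w , v≡ =
          dominated-by-hub u P≡ (Adj-sym G (proj₁ (proj₂ (coherent-as G _ (coherent v) v≡))))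
                           (trans (home-knee v≡) (sym (home-centre u≡))) v≡ refl
        by-label (leaf c)   u≡ (c≡ , u~c) hub P≡ =
          dominated-by-hub u P≡ u~c (trans (home-centre c≡) (sym (home-leaf u≡))) c≡ refl
        by-label (leaf c)   u≡ _ spread   P≡ = contradiction 2fu<k (self-sufficient u P≡ u≡ k≤2h)
        by-label (leaf c)   u≡ _ kneeHubs P≡ = contradiction 2fu<k (self-sufficient u P≡ u≡ k≤2h)
        by-label (knee c w) u≡ (c≡ , u~c , _) hub P≡ =
          dominated-by-hub u P≡ u~c (trans (home-centre c≡) (sym (home-knee u≡))) c≡ refl
        by-label (knee c w) u≡ (c≡ , u~c , w≡) spread P≡ =
          dominated-by-pair u P≡ u~c (Adj-sym G (proj₂ (coherent-as G _ (coherent w) w≡)))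
                            (distinct c≡ w≡ λ ())
                            (trans (home-centre c≡) (sym (home-knee u≡)))
                            (trans (home-foot w≡ u≡) (sym (home-knee u≡))) c≡ w≡ refl refl
        by-label (knee c w) u≡ _ kneeHubs P≡ = contradiction 2fu<k (self-sufficient u P≡ u≡ (<⇒≤ k<2k))
        by-label (foot v)   u≡ _ hub      P≡ = contradiction 2fu<k (self-sufficient u P≡ u≡ k≤2h)
        by-label (foot v)   u≡ _ spread   P≡ = contradiction 2fu<k (self-sufficient u P≡ u≡ (<⇒≤ k<2s))
        by-label (foot v)   u≡ ((c , v≡) , u~v) kneeHubs P≡ =
          dominated-by-hub u P≡ u~v (trans (home-knee v≡) (sym (home-foot u≡ v≡))) v≡ refl

      dominated : ∀ u → 2 * f u < k → k ≤ f u + nbSum G f u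
      dominated u 2fu<k with halves? (patternAt (home u))
      ... | no ≢halves =
        ≤-trans (strongly-dominated u ≢halves 2fu<k) (+-monoʳ-≤ (f u) (strongNbSum≤nbSum G f u k))
      ... | yes P≡ = by-label (L u) refl (coherent u)
        where
        by-label : ∀ d → L u ≡ d → CoherentAt G L u d → k ≤ f u + nbSum G f u
        by-label outside    u≡ _ = contradiction u≡ (covered u)
        by-label centre     u≡ _ = contradiction 2fu<k (self-sufficient u P≡ u≡ k≤2h)
        by-label (leaf _)   u≡ _ = contradiction 2fu<k (self-sufficient u P≡ u≡ k≤2h)
        by-label (foot _)   u≡ _ = contradiction 2fu<k (self-sufficient u P≡ u≡ k≤2h)
        by-label (knee c w) u≡ (c≡ , u~c , w≡) =
          ≤-trans (≤-trans k≤h+h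
                           (subst (_≤ nbSum G f u) (cong₂ _+_ fc≡ fw≡)
                                  (nbSum-neighbours G f u u~c u~w (distinct c≡ w≡ λ ()))))
                  (m≤n+m _ (f u))
          where
          u~w : Adj G u w
          u~w = Adj-sym G (proj₂ (coherent-as G _ (coherent w) w≡))
          fc≡ : f c ≡ h
          fc≡ = value u P≡ (trans (home-centre c≡) (sym (home-knee u≡))) c≡
          fw≡ : f w ≡ h
          fw≡ = value u P≡ (trans (home-foot w≡ u≡) (sym (home-knee u≡))) w≡

-- Weighting schemes

≤-by-gap : ∀ {x y} gap → x + gap ≡ y → x ≤ y
≤-by-gap {x} gap e = subst (x ≤_) e (m≤m+n x gap)

-- A record, so that fits-by-gap can read the four weights off by unification and the ring
-- solver sees a polynomial goal.
record Fits (q p : ℕ) (W : Weights) (A B : ℕ) : Set where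
  constructor fits
  field
    fits-proof : q * spiderSum W A B ≤ spiderSum (uniform p) A B

fits-by-gap : ∀ {q p c l kn ft A B} gap →
              q * (c + l * A + (kn + ft) * B) + gap ≡ p + p * A + (p + p) * B →
              Fits q p ⟨ c , l , kn , ft ⟩ A B
fits-by-gap gap e = fits (≤-by-gap gap e)

record Scheme (k q p : ℕ) : Set where
  field
    h s           : ℕ
    choose        : ℕ → ℕ → Pattern
    k-positive    : 1 ≤ k
    h≤k           : h ≤ k
    s≤k           : s ≤ k
    k≤2h          : k ≤ 2 * h
    k<2s          : k < 2 * s
    kneeHubs⇒knee : ∀ A B → choose A B ≡ kneeHubs → 0 < B
    spiders-fit   : ∀ A B → 2 ≤ A ⊎ 0 < B → Fits q p (weights k h s (choose A B)) A B

module _ {n} {G : SimpleGraph n} (cover : SpiderCover G) {k q p} (S : Scheme k q p) where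

  private
    open SpiderCover cover renaming (labelling to L)
    open Scheme S
    open Spiders L coherent covered
    open Valuation k h s choose
    open Dominating k-positive k≤2h k<2s kneeHubs⇒knee

    weight≤ : q * weight f ≤ p * n
    weight≤ = subst (λ x → q * x ≤ p * n) (sym (Σᵥ≡sum f))
                    (weight-bound (λ c → weights k h s (patternAt c)) q p
                                  (λ c c≡ → Fits.fits-proof
                                     (spiders-fit (leaves c) (knees c) (Big⇒2≤leaves⊎0<knees (big c c≡)))))

  scheme⇒γ-bound : γ-bound k G q p
  scheme⇒γ-bound = f , (f-bounded h≤k s≤k , dominated) , weight≤

  scheme⇒γs-bound : (∀ A B → Scheme.choose S A B ≢ halves) → γs-bound k G q p
  scheme⇒γs-bound no-halves =
    f , (f-bounded h≤k s≤k , λ u → strongly-dominated u (no-halves _ _)) , weight≤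

spreadChoice : ℕ → ℕ → Pattern
spreadChoice (suc _) _ = hub
spreadChoice zero    1 = kneeHubs
spreadChoice zero    _ = spread

halvesChoice : ℕ → ℕ → Pattern
halvesChoice (suc _) _ = hub
halvesChoice zero    _ = halves

hubChoice : ℕ → ℕ → Pattern
hubChoice zero 1 = kneeHubs
hubChoice _    _ = hub

odd-scheme : ∀ m → Scheme (3 + 2 * m) 8 (3 * (3 + 2 * m) + 1)
odd-scheme m = record
  { h = 2 + m ; s = 2 + m ; choose = spreadChoice
  ; k-positive = s≤s z≤n
  ; h≤k = ≤-by-gap (1 + m) (solve (m ∷ []))
  ; s≤k = ≤-by-gap (1 + m) (solve (m ∷ []))
  ; k≤2h = ≤-by-gap 1 (solve (m ∷ []))
  ; k<2s = ≤-by-gap 0 (solve (m ∷ []))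
  ; kneeHubs⇒knee = λ { zero 1 _ → s≤s z≤n ; zero 0 () ; zero (suc (suc _)) () ; (suc _) _ () }
  ; spiders-fit = spiders-fit
  }
  where
  spiders-fit : ∀ A B → 2 ≤ A ⊎ 0 < B →
                Fits 8 (3 * (3 + 2 * m) + 1) (weights (3 + 2 * m) (2 + m) (2 + m) (spreadChoice A B)) A B
  spiders-fit (suc (suc a)) B _ = fits-by-gap
                                    (6 + 4 * B + 4 * B * m + 10 * a + 6 * a * m + 2 * m)
                                    (solve (m ∷ a ∷ B ∷ []))
  spiders-fit 1 (suc b)       _ = fits-by-gap (4 * b + 4 * b * m) (solve (m ∷ b ∷ []))
  spiders-fit 0 1             _ = fits-by-gap (6 + 2 * m) (solve (m ∷ []))
  spiders-fit 0 (suc (suc b)) _ = fits-by-gap (2 + 4 * b + 4 * b * m + 6 * m) (solve (m ∷ b ∷ []))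
  spiders-fit 0 0 (inj₁ ())
  spiders-fit 0 0 (inj₂ ())
  spiders-fit 1 0 (inj₁ (s≤s ()))
  spiders-fit 1 0 (inj₂ ())

even-scheme : ∀ m → Scheme (2 + 2 * m) 8 (3 * (2 + 2 * m))
even-scheme m = record
  { h = 1 + m ; s = 2 + m ; choose = halvesChoice
  ; k-positive = s≤s z≤n
  ; h≤k = ≤-by-gap (1 + m) (solve (m ∷ []))
  ; s≤k = ≤-by-gap m (solve (m ∷ []))
  ; k≤2h = ≤-by-gap 0 (solve (m ∷ []))
  ; k<2s = ≤-by-gap 1 (solve (m ∷ []))
  ; kneeHubs⇒knee = λ { zero _ () ; (suc _) _ () }
  ; spiders-fit = spiders-fit
  }
  where
  spiders-fit : ∀ A B → 2 ≤ A ⊎ 0 < B →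
                Fits 8 (3 * (2 + 2 * m)) (weights (2 + 2 * m) (1 + m) (2 + m) (halvesChoice A B)) A B
  spiders-fit (suc (suc a)) B _ = fits-by-gap
                                    (2 + 4 * B + 4 * B * m + 6 * a + 6 * a * m + 2 * m)
                                    (solve (m ∷ a ∷ B ∷ []))
  spiders-fit 1 (suc b)       _ = fits-by-gap (4 * b + 4 * b * m) (solve (m ∷ b ∷ []))
  spiders-fit 0 (suc b)       _ = fits-by-gap (2 + 4 * b + 4 * b * m + 2 * m) (solve (m ∷ b ∷ []))
  spiders-fit 0 0 (inj₁ ())
  spiders-fit 0 0 (inj₂ ())
  spiders-fit 1 0 (inj₁ (s≤s ()))
  spiders-fit 1 0 (inj₂ ())

two-fifths-scheme : ∀ m → Scheme (2 + 2 * m) 5 (2 * (2 + 2 * m))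
two-fifths-scheme m = record
  { h = 1 + m ; s = 2 + m ; choose = hubChoice
  ; k-positive = s≤s z≤n
  ; h≤k = ≤-by-gap (1 + m) (solve (m ∷ []))
  ; s≤k = ≤-by-gap m (solve (m ∷ []))
  ; k≤2h = ≤-by-gap 0 (solve (m ∷ []))
  ; k<2s = ≤-by-gap 1 (solve (m ∷ []))
  ; kneeHubs⇒knee = λ { zero 1 _ → s≤s z≤n ; zero 0 () ; zero (suc (suc _)) () ; (suc _) _ () }
  ; spiders-fit = spiders-fit
  }
  where
  spiders-fit : ∀ A B → 2 ≤ A ⊎ 0 < B →
                Fits 5 (2 * (2 + 2 * m)) (weights (2 + 2 * m) (1 + m) (2 + m) (hubChoice A B)) A B
  spiders-fit (suc (suc a)) B _ = fits-by-gap
                                    (2 + 3 * B + 3 * B * m + 4 * a + 4 * a * m + 2 * m)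
                                    (solve (m ∷ a ∷ B ∷ []))
  spiders-fit 1 (suc b)       _ = fits-by-gap (1 + 3 * b + 3 * b * m + m) (solve (m ∷ b ∷ []))
  spiders-fit 0 1             _ = fits-by-gap (2 + 2 * m) (solve (m ∷ []))
  spiders-fit 0 (suc (suc b)) _ = fits-by-gap (3 * b + 3 * b * m) (solve (m ∷ b ∷ []))
  spiders-fit 0 0 (inj₁ ())
  spiders-fit 0 0 (inj₂ ())
  spiders-fit 1 0 (inj₁ (s≤s ()))
  spiders-fit 1 0 (inj₂ ())

large-even-scheme : ∀ m → Scheme (8 + 2 * m) 8 (3 * (8 + 2 * m))
large-even-scheme m = record
  { h = 4 + m ; s = 5 + m ; choose = spreadChoice
  ; k-positive = s≤s z≤n
  ; h≤k = ≤-by-gap (4 + m) (solve (m ∷ []))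
  ; s≤k = ≤-by-gap (3 + m) (solve (m ∷ []))
  ; k≤2h = ≤-by-gap 0 (solve (m ∷ []))
  ; k<2s = ≤-by-gap 1 (solve (m ∷ []))
  ; kneeHubs⇒knee = λ { zero 1 _ → s≤s z≤n ; zero 0 () ; zero (suc (suc _)) () ; (suc _) _ () }
  ; spiders-fit = spiders-fit
  }
  where
  spiders-fit : ∀ A B → 2 ≤ A ⊎ 0 < B →
                Fits 8 (3 * (8 + 2 * m)) (weights (8 + 2 * m) (4 + m) (5 + m) (spreadChoice A B)) A B
  spiders-fit (suc (suc a)) B _ = fits-by-gap
                                    (8 + 16 * B + 4 * B * m + 24 * a + 6 * a * m + 2 * m)
                                    (solve (m ∷ a ∷ B ∷ []))
  spiders-fit 1 (suc b)       _ = fits-by-gap (16 * b + 4 * b * m) (solve (m ∷ b ∷ []))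
  spiders-fit 0 1             _ = fits-by-gap (8 + 2 * m) (solve (m ∷ []))
  spiders-fit 0 (suc (suc b)) _ = fits-by-gap (8 * b + 4 * b * m + 6 * m) (solve (m ∷ b ∷ []))
  spiders-fit 0 0 (inj₁ ())
  spiders-fit 0 0 (inj₂ ())
  spiders-fit 1 0 (inj₁ (s≤s ()))
  spiders-fit 1 0 (inj₂ ())

spreadChoice-no-halves : ∀ A B → spreadChoice A B ≢ halves
spreadChoice-no-halves (suc _) _             ()
spreadChoice-no-halves zero    1             ()
spreadChoice-no-halves zero    0             ()
spreadChoice-no-halves zero    (suc (suc _)) ()

hubChoice-no-halves : ∀ A B → hubChoice A B ≢ halves
hubChoice-no-halves zero    1             ()
hubChoice-no-halves zero    0             ()
hubChoice-no-halves zero    (suc (suc _)) ()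
hubChoice-no-halves (suc _) _             ()

odd-form : ∀ k → 2 ≤ k → k % 2 ≡ 1 → ∃[ m ] k ≡ 3 + 2 * m
odd-form 1 (s≤s ()) _
odd-form 3 _ _ = 0 , refl
odd-form (suc (suc k@(suc (suc _)))) _ odd with odd-form k (s≤s (s≤s z≤n)) odd
... | m , refl = suc m , cong (3 +_) (sym (*-suc 2 m))

even-form : ∀ k → 2 ≤ k → k % 2 ≡ 0 → ∃[ m ] k ≡ 2 + 2 * m
even-form 2 _ _ = 0 , refl
even-form (suc (suc k@(suc (suc _)))) _ even with even-form k (s≤s (s≤s z≤n)) even
... | m , refl = suc m , cong (2 +_) (sym (*-suc 2 m))

large-even-form : ∀ k → 8 ≤ k → k % 2 ≡ 0 → ∃[ m ] k ≡ 8 + 2 * m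
large-even-form k 8≤k even with even-form k (≤-trans (s≤s (s≤s z≤n)) 8≤k) even | 8≤k
... | 0 , refl | s≤s (s≤s ())
... | 1 , refl | s≤s (s≤s (s≤s (s≤s ())))
... | 2 , refl | s≤s (s≤s (s≤s (s≤s (s≤s (s≤s ())))))
... | suc (suc (suc m)) , refl | _ = m , cong (2 +_) (*-distribˡ-+ 2 3 m)

theorem3p1 : (k n : ℕ) → 2 ≤ k → 3 ≤ n → (T : SimpleGraph n) → IsTree T →
    ((k % 2 ≡ 1 → γ-bound k T 8 (3 * k + 1))
     × (k % 2 ≡ 0 → γ-bound k T 8 (3 * k)))
    × ((k % 2 ≡ 1 → γs-bound k T 8 (3 * k + 1))
     × ((k ≡ 2 ⊎ k ≡ 4 ⊎ k ≡ 6) → γs-bound k T 5 (2 * k))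
     × (8 ≤ k → k % 2 ≡ 0 → γs-bound k T 8 (3 * k)))
theorem3p1 k (suc (suc (suc _))) 2≤k (s≤s (s≤s (s≤s _))) T (connected , _) =
  (odd-γ , even-γ) , (odd-γs , small-γs , large-γs)
  where
  cover : SpiderCover T
  cover = spider-cover T connected {zero} {suc zero} {suc (suc zero)} (λ ()) (λ ()) (λ ())
  odd-γs : k % 2 ≡ 1 → γs-bound k T 8 (3 * k + 1)
  odd-γs odd with odd-form k 2≤k odd
  ... | m , refl = scheme⇒γs-bound cover (odd-scheme m) spreadChoice-no-halves
  odd-γ : k % 2 ≡ 1 → γ-bound k T 8 (3 * k + 1)
  odd-γ odd with odd-form k 2≤k odd
  ... | m , refl = scheme⇒γ-bound cover (odd-scheme m)
  even-γ : k % 2 ≡ 0 → γ-bound k T 8 (3 * k)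
  even-γ even with even-form k 2≤k even
  ... | m , refl = scheme⇒γ-bound cover (even-scheme m)
  small-γs : k ≡ 2 ⊎ k ≡ 4 ⊎ k ≡ 6 → γs-bound k T 5 (2 * k)
  small-γs (inj₁ refl)        = scheme⇒γs-bound cover (two-fifths-scheme 0) hubChoice-no-halves
  small-γs (inj₂ (inj₁ refl)) = scheme⇒γs-bound cover (two-fifths-scheme 1) hubChoice-no-halves
  small-γs (inj₂ (inj₂ refl)) = scheme⇒γs-bound cover (two-fifths-scheme 2) hubChoice-no-halves
  large-γs : 8 ≤ k → k % 2 ≡ 0 → γs-bound k T 8 (3 * k)
  large-γs 8≤k even with large-even-form k 8≤k even
  ... | m , refl = scheme⇒γs-bound cover (large-even-scheme m) spreadChoice-no-halves
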